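{- Let $k\ge 0$ be an integer and let $G$ be a graph with maximum degree $\Delta$. Then $\mathrm{va}_k^{\equiv}(G)=1$ if and only if $G$ is a forest and $k\geq \Delta$.
   Context: A $t$-coloring of a graph $G$ is any map $f:V(G)\to\{1,\dots,t\}$ (not necessarily proper), with color classes $V_i=f^{ -1}(i)$ (possibly empty); it is equitable if $||V_i|-|V_j||\le 1$ for all $i,j$. For a nonnegative integer $k$, a $(t,k)$-tree-coloring is a $t$-coloring such that every component of each induced subgraph $G[V_i]$ is a tree of maximum degree at most $k$. The strong equitable vertex $k$-arboricity $\mathrm{va}_k^{\equiv}(G)$ is the smallest positive integer $t$ such that $G$ has an equitable $(t',k)$-tree-coloring for every integer $t'\ge t$. -}

module Defs where

open import Data.Nat using (ℕ; zero; suc; _+_; _≤_; _<_; _⊔_)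
open import Data.Fin using (Fin; zero; suc; inject₁; fromℕ; _≟_)
open import Data.Bool using (Bool; true; false; if_then_else_)
open import Data.Product using (Σ; _×_)
open import Relation.Nullary using (¬_; does)
open import Relation.Binary.PropositionalEquality using (_≡_; _≢_)
open import Function.Definitions using (Injective)

record Graph (n : ℕ) : Set where
  field
    adj     : Fin n → Fin n → Bool
    symm    : ∀ u v → adj u v ≡ adj v u
    irrefl  : ∀ v → adj v v ≡ false
open Graph public

count : ∀ {n} → (Fin n → Bool) → ℕ
count {zero}  p = 0
count {suc n} p = (if p zero then 1 else 0) + count (λ i → p (suc i))

maxOver : ∀ {n} → (Fin n → ℕ) → ℕ
maxOver {zero}  f = 0
maxOver {suc n} f = f zero ⊔ maxOver (λ i → f (suc i))

VSet : ℕ → Set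
VSet n = Fin n → Bool

_∧ᵇ_ : Bool → Bool → Bool
true  ∧ᵇ b = b
false ∧ᵇ b = false

-- degree of v in the induced subgraph G[S] (v assumed in S)
degIn : ∀ {n} → Graph n → VSet n → Fin n → ℕ
degIn G S v = count (λ u → S u ∧ᵇ adj G v u)

deg : ∀ {n} → Graph n → Fin n → ℕ
deg G v = count (λ u → adj G v u)

maxDegree : ∀ {n} → Graph n → ℕ
maxDegree G = maxOver (deg G)

-- a cycle of length m+3 in G[S]: distinct vertices c 0, …, c (m+2), all in S,
-- consecutive ones adjacent, and the last adjacent to the first
record CycleIn {n : ℕ} (G : Graph n) (S : VSet n) (m : ℕ) : Set where
  field
    c       : Fin (suc (suc (suc m))) → Fin n
    inj     : Injective _≡_ _≡_ c
    inS     : ∀ i → S (c i) ≡ true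
    step    : ∀ (i : Fin (suc (suc m))) → adj G (c (inject₁ i)) (c (suc i)) ≡ true
    close   : adj G (c (fromℕ (suc (suc m)))) (c zero) ≡ true

ForestIn : ∀ {n} → Graph n → VSet n → Set
ForestIn G S = ∀ m → ¬ CycleIn G S m

all : ∀ {n} → VSet n
all _ = true

Forest : ∀ {n} → Graph n → Set
Forest G = ForestIn G all

colourClass : ∀ {n t} → (Fin n → Fin t) → Fin t → VSet n
colourClass f i v = does (f v ≟ i)

Equitable : ∀ {n t} → (Fin n → Fin t) → Set
Equitable {t = t} f = ∀ (i j : Fin t) →
  count (colourClass f i) ≤ count (colourClass f j) + 1

TreeColouring : ∀ {n t} → Graph n → ℕ → (Fin n → Fin t) → Set
TreeColouring {t = t} G k f = ∀ (i : Fin t) →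
  ForestIn G (colourClass f i) ×
  (∀ v → colourClass f i v ≡ true → degIn G (colourClass f i) v ≤ k)

HasEqTreeColouring : ∀ {n} → Graph n → ℕ → ℕ → Set
HasEqTreeColouring {n} G k t =
  Σ (Fin n → Fin t) (λ f → Equitable f × TreeColouring G k f)

IsStrongEqVA : ∀ {n} → Graph n → ℕ → ℕ → Set
IsStrongEqVA G k t =
  1 ≤ t ×
  (∀ t' → t ≤ t' → HasEqTreeColouring G k t') ×
  (∀ s → 1 ≤ s → s < t → ¬ (∀ t' → s ≤ t' → HasEqTreeColouring G k t'))

-- Colour the vertices one at a time, each with a currently least-used colour:
-- this keeps all colour classes within one of each other, so every t ≥ 1
-- admits an equitable t-colouring. When G is a forest with Δ(G) ≤ k, every
-- colouring is a (t,k)-tree-colouring, since induced subgraphs of a forest are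
-- forests and degrees only drop in induced subgraphs; hence va_k^≡(G) = 1.
-- Conversely, the only 1-colouring has G itself as its colour class.
module Submission where

open import Defs
open import Data.Nat using (ℕ; zero; suc; _+_; _≤_; z≤n; s≤s; _≤?_)
open import Data.Nat.Properties
  using (≤-refl; ≤-reflexive; ≤-trans; m≤m⊔n; m≤n⊔m; ⊔-lub; n≤1+n; ≰⇒>; <⇒≱; +-comm; +-monoˡ-≤)
open import Data.Fin using (Fin; _≟_) renaming (zero to fzero; suc to fsuc)
open import Data.Bool using (Bool; true; false; if_then_else_)
open import Data.Product using (Σ; _×_; _,_; proj₁; proj₂)
open import Relation.Nullary using (does; yes; no)
open import Relation.Binary.PropositionalEquality using (_≡_; refl; cong)
open import Function.Bundles using (_⇔_; mk⇔)

count-∧ᵇ-≤ : ∀ {n} (p q : Fin n → Bool) → count (λ u → p u ∧ᵇ q u) ≤ count q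
count-∧ᵇ-≤ {zero}  p q = z≤n
count-∧ᵇ-≤ {suc n} p q with p fzero | q fzero
... | true  | true  = s≤s (count-∧ᵇ-≤ (λ i → p (fsuc i)) (λ i → q (fsuc i)))
... | true  | false = count-∧ᵇ-≤ (λ i → p (fsuc i)) (λ i → q (fsuc i))
... | false | true  = ≤-trans (count-∧ᵇ-≤ (λ i → p (fsuc i)) (λ i → q (fsuc i))) (n≤1+n _)
... | false | false = count-∧ᵇ-≤ (λ i → p (fsuc i)) (λ i → q (fsuc i))

count-cong : ∀ {n} {p q : Fin n → Bool} → (∀ u → p u ≡ q u) → count p ≡ count q
count-cong {zero}          p≡q = refl
count-cong {suc n} {p} {q} p≡q rewrite p≡q fzero = cong (_ +_) (count-cong (λ i → p≡q (fsuc i)))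

≤-maxOver : ∀ {n} (f : Fin n → ℕ) v → f v ≤ maxOver f
≤-maxOver f fzero    = m≤m⊔n _ _
≤-maxOver f (fsuc v) = ≤-trans (≤-maxOver (λ i → f (fsuc i)) v) (m≤n⊔m _ _)

maxOver-lub : ∀ {n} (f : Fin n → ℕ) {k} → (∀ v → f v ≤ k) → maxOver f ≤ k
maxOver-lub {zero}  f f≤k = z≤n
maxOver-lub {suc n} f f≤k = ⊔-lub (f≤k fzero) (maxOver-lub (λ i → f (fsuc i)) (λ i → f≤k (fsuc i)))

degIn≤maxDegree : ∀ {n} (G : Graph n) (S : VSet n) v → degIn G S v ≤ maxDegree G
degIn≤maxDegree G S v = ≤-trans (count-∧ᵇ-≤ S (adj G v)) (≤-maxOver (deg G) v)

ForestIn-anti : ∀ {n} (G : Graph n) {S T : VSet n} → (∀ u → S u ≡ true → T u ≡ true) →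
  ForestIn G T → ForestIn G S
ForestIn-anti G S⊆T forestT m cycle = forestT m record
  { c = c ; inj = inj ; inS = λ i → S⊆T (c i) (inS i) ; step = step ; close = close }
  where open CycleIn cycle

forest⇒treeColouring : ∀ {n t k} (G : Graph n) → Forest G → maxDegree G ≤ k →
  (f : Fin n → Fin t) → TreeColouring G k f
forest⇒treeColouring G forest Δ≤k f i =
  ForestIn-anti G (λ _ _ → refl) forest , λ v _ → ≤-trans (degIn≤maxDegree G _ v) Δ≤k

treeColouring₁⇒forest : ∀ {n k} (G : Graph n) (f : Fin n → Fin 1) →
  TreeColouring G k f → Forest G × maxDegree G ≤ k
treeColouring₁⇒forest G f treeCol =
  ForestIn-anti G (λ u _ → inClass u) forestClass ,
  maxOver-lub (deg G) (λ v → ≤-trans (≤-reflexive (deg≡degIn v)) (class≤k v (inClass v)))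
  where
  forestClass = proj₁ (treeCol fzero)
  class≤k = proj₂ (treeCol fzero)

  inClass : ∀ u → colourClass f fzero u ≡ true
  inClass u with f u
  ... | fzero = refl

  deg≡degIn : ∀ v → deg G v ≡ degIn G (colourClass f fzero) v
  deg≡degIn v = count-cong (λ u → ∧ᵇ-identityˡ (inClass u))
    where
    ∧ᵇ-identityˡ : ∀ {a b} → a ≡ true → b ≡ (a ∧ᵇ b)
    ∧ᵇ-identityˡ refl = refl

minimiser : ∀ {t} (c : Fin (suc t) → ℕ) → Σ (Fin (suc t)) (λ j → ∀ i → c j ≤ c i)
minimiser {zero}  c = fzero , λ { fzero → ≤-refl }
minimiser {suc t} c with minimiser (λ i → c (fsuc i))
... | j , cj≤ with c fzero ≤? c (fsuc j)
...   | yes c0≤cj = fzero , λ { fzero → ≤-refl ; (fsuc i) → ≤-trans c0≤cj (cj≤ i) }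
...   | no  c0≰cj = fsuc j , λ { fzero → ≤-trans (n≤1+n _) (≰⇒> c0≰cj) ; (fsuc i) → cj≤ i }

increment : ∀ {t} → Fin t → (Fin t → ℕ) → Fin t → ℕ
increment j c i = (if does (j ≟ i) then 1 else 0) + c i

≤-increment : ∀ {t} j (c : Fin t → ℕ) i → c i ≤ increment j c i
≤-increment j c i with j ≟ i
... | yes _ = n≤1+n _
... | no  _ = ≤-refl

increment-min-preserves-spread : ∀ {t} (c : Fin t → ℕ) j → (∀ i → c j ≤ c i) →
  (∀ i i' → c i ≤ c i' + 1) → ∀ i i' → increment j c i ≤ increment j c i' + 1
increment-min-preserves-spread c j cj≤ spread i i' with j ≟ i
... | yes refl = ≤-trans (≤-reflexive (+-comm 1 (c j)))
                         (+-monoˡ-≤ 1 (≤-trans (cj≤ i') (≤-increment j c i')))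
... | no  _    = ≤-trans (spread i i') (+-monoˡ-≤ 1 (≤-increment j c i'))

classSizes : ∀ {n t} → (Fin n → Fin t) → Fin t → ℕ
classSizes f i = count (colourClass f i)

leastUsedColouring : ∀ t n → Fin n → Fin (suc t)
leastUsedColouring t (suc n) fzero    = proj₁ (minimiser (classSizes (leastUsedColouring t n)))
leastUsedColouring t (suc n) (fsuc v) = leastUsedColouring t n v

leastUsedColouring-equitable : ∀ t n → Equitable (leastUsedColouring t n)
leastUsedColouring-equitable t zero    i j = z≤n
leastUsedColouring-equitable t (suc n) =
  increment-min-preserves-spread (classSizes (leastUsedColouring t n)) _
    (proj₂ (minimiser (classSizes (leastUsedColouring t n))))
    (leastUsedColouring-equitable t n)

proposition3p2 : ∀ (k n : ℕ) (G : Graph n) →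
    IsStrongEqVA G k 1 ⇔ (Forest G × maxDegree G ≤ k)
proposition3p2 k n G = mk⇔ necessary sufficient
  where
  necessary : IsStrongEqVA G k 1 → Forest G × maxDegree G ≤ k
  necessary (_ , colourable , _) with colourable 1 ≤-refl
  ... | f , _ , treeCol = treeColouring₁⇒forest G f treeCol

  sufficient : Forest G × maxDegree G ≤ k → IsStrongEqVA G k 1
  sufficient (forest , Δ≤k) = ≤-refl , colourable , λ s 1≤s s<1 _ → <⇒≱ s<1 1≤s
    where
    colourable : ∀ t → 1 ≤ t → HasEqTreeColouring G k t
    colourable (suc t) _ =
      leastUsedColouring t n , leastUsedColouring-equitable t n ,
      forest⇒treeColouring G forest Δ≤k (leastUsedColouring t n)
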